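{- Let $N$ be a binary network on $n$ leaves with reticulation number $r$, and let $P$ be a cherry decomposition of $N$. Then $P$ contains exactly $n-1$ cherry shapes and exactly $r$ reticulated cherry shapes.
   Context: A (phylogenetic) network $N$ on a finite set $X$ is a directed acyclic graph with a unique vertex of indegree $0$ and outdegree $1$ (the root), vertices of indegree $1$ and outdegree $0$ (the leaves) bijectively labelled by $X$, and in which every other vertex has either indegree $1$ (a tree vertex) or outdegree $1$ (a reticulation), but not both. The edge leaving the root is the root edge. A reticulation edge is an edge whose head is a reticulation; the reticulation number is the number of reticulation edges minus the number of reticulations. $N$ is binary if every vertex has total degree at most $3$. A cherry shape is a subgraph on three distinct vertices $x,y,p$ with edges $px$ and $py$. A reticulated cherry shape is a subgraph on four vertices $x,y,p_x,p_y$ with edges $p_xx$, $p_yp_x$, $p_yy$, where $p_x$ is a reticulation. A cherry decomposition of a binary network is a set $P$ of cherry shapes and reticulated cherry shapes such that every edge other than the root edge belongs to exactly one shape in $P$. -}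

module Defs where

open import Data.Nat using (ℕ; _+_; _∸_; _≤_; _≡ᵇ_)
open import Data.Fin using (Fin)
open import Data.Fin.Properties using (_≟_)
open import Data.Bool using (Bool; true; false; T; _∧_; _∨_; not)
import Data.List.Membership.Propositional
open import Data.List using (List; length; filterᵇ; allFin; map)
open import Data.Nat.ListAction using (sum)
open import Data.Product using (_×_)
open import Data.Sum using (_⊎_)
open import Relation.Nullary using (¬_; ⌊_⌋)
open import Relation.Binary.PropositionalEquality using (_≡_; _≢_)

module _ {m : ℕ} (E : Fin m → Fin m → Bool) where

  _==_ : Fin m → Fin m → Bool
  u == v = ⌊ u ≟ v ⌋

  indeg : Fin m → ℕ
  indeg v = length (filterᵇ (λ u → E u v) (allFin m))

  outdeg : Fin m → ℕ
  outdeg u = length (filterᵇ (λ v → E u v) (allFin m))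

  isLeafᵇ : Fin m → Bool
  isLeafᵇ v = (indeg v ≡ᵇ 1) ∧ (outdeg v ≡ᵇ 0)

  -- n = number of leaves (the leaves are bijectively labelled by X)
  nLeaves : ℕ
  nLeaves = length (filterᵇ isLeafᵇ (allFin m))

  data Path⁺ : Fin m → Fin m → Set where
    edge : ∀ {u v} → T (E u v) → Path⁺ u v
    step : ∀ {u v w} → T (E u v) → Path⁺ v w → Path⁺ u w

  Acyclic : Set
  Acyclic = ∀ v → ¬ Path⁺ v v

  IsBinary : Set
  IsBinary = ∀ v → indeg v + outdeg v ≤ 3

record IsNetwork (m : ℕ) (E : Fin m → Fin m → Bool) : Set where
  field
    acyclic     : Acyclic E
    root        : Fin m
    root-in     : indeg E root ≡ 0
    root-out    : outdeg E root ≡ 1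
    root-unique : ∀ v → indeg E v ≡ 0 → v ≡ root
    other       : ∀ v → v ≢ root → ¬ T (isLeafᵇ E v) →
                  (indeg E v ≡ 1 × outdeg E v ≢ 1) ⊎ (outdeg E v ≡ 1 × indeg E v ≢ 1)

module _ {m : ℕ} {E : Fin m → Fin m → Bool} (N : IsNetwork m E) where
  open IsNetwork N

  isRetᵇ : Fin m → Bool
  isRetᵇ v = not (_==_ E v root) ∧ not (isLeafᵇ E v) ∧ (outdeg E v ≡ᵇ 1)

  numReticulations : ℕ
  numReticulations = length (filterᵇ isRetᵇ (allFin m))

  numReticulationEdges : ℕ
  numReticulationEdges =
    sum (map (λ v → length (filterᵇ (λ u → E u v ∧ isRetᵇ v) (allFin m))) (allFin m))

  -- reticulation number (always ≥ 0, so truncated subtraction is exact)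
  reticulationNumber : ℕ
  reticulationNumber = numReticulationEdges ∸ numReticulations

-- Shapes: cherry p x y  (edges p→x, p→y);
-- reticulated cherry x y pₓ p_y (edges pₓ→x, p_y→pₓ, p_y→y, pₓ a reticulation)
data Shape (m : ℕ) : Set where
  cherry    : (p x y : Fin m) → Shape m
  retCherry : (x y px py : Fin m) → Shape m

isCherryᵇ : {m : ℕ} → Shape m → Bool
isCherryᵇ (cherry _ _ _) = true
isCherryᵇ (retCherry _ _ _ _) = false

isRetCherryᵇ : {m : ℕ} → Shape m → Bool
isRetCherryᵇ s = not (isCherryᵇ s)

module _ {m : ℕ} {E : Fin m → Fin m → Bool} (N : IsNetwork m E) where
  open IsNetwork N

  ValidShape : Shape m → Set
  ValidShape (cherry p x y) =
    (p ≢ x × p ≢ y × x ≢ y) × T (E p x) × T (E p y)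
  ValidShape (retCherry x y px py) =
    (x ≢ y × x ≢ px × x ≢ py × y ≢ px × y ≢ py × px ≢ py)
    × T (E px x) × T (E py px) × T (E py y) × T (isRetᵇ N px)

  edgeInᵇ : Fin m → Fin m → Shape m → Bool
  edgeInᵇ u v (cherry p x y) =
    (_==_ E u p ∧ _==_ E v x) ∨ (_==_ E u p ∧ _==_ E v y)
  edgeInᵇ u v (retCherry x y px py) =
    (_==_ E u px ∧ _==_ E v x) ∨ (_==_ E u py ∧ _==_ E v px) ∨ (_==_ E u py ∧ _==_ E v y)

  record IsCherryDecomposition (P : List (Shape m)) : Set where
    field
      valid : ∀ s → s Data.List.Membership.Propositional.∈ P → ValidShape s
      cover : ∀ u v → T (E u v) → u ≢ root →
              length (filterᵇ (edgeInᵇ u v) P) ≡ 1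

numCherries : {m : ℕ} → List (Shape m) → ℕ
numCherries P = length (filterᵇ isCherryᵇ P)

numRetCherries : {m : ℕ} → List (Shape m) → ℕ
numRetCherries P = length (filterᵇ isRetCherryᵇ P)

module Submission where

-- The proof double counts edges.  In a binary network every vertex is the root
-- (indegree 0, outdegree 1), a leaf (1, 0), a tree vertex (1, 2) or a
-- reticulation (2, 1), so 2·indeg v + [v root] = outdeg v + 2·[v leaf] + 3·[v ret];
-- summing with the handshake lemma gives 2D + 1 = D + 2n + 3ρ for D edges and ρ
-- reticulations, and r = 2ρ − ρ = ρ.  A cherry decomposition covers every edge
-- except the root edge exactly once; a cherry covers two and a reticulated cherry
-- three of them, so D = 1 + 2c + 3k.  The edges leaving reticulations (one per
-- reticulation) are exactly the edges p_x → x, one per reticulated cherry, so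
-- k = ρ, and arithmetic gives n = 1 + c.

open import Defs
open import Data.Nat using (ℕ; zero; suc; _+_; _*_; _∸_; _≤_; _≡ᵇ_; s≤s; s≤s⁻¹)
open import Data.Nat.Properties
  using (+-*-semiring; +-comm; +-identityʳ; *-identityʳ; *-comm; *-distribʳ-+; *-assoc; +-assoc; +-cancelˡ-≡; +-cancelʳ-≡; *-cancelˡ-≡; module ≤-Reasoning; ≤-trans; ≤-reflexive; m≤m+n; m≤n+m; +-monoʳ-≤; m+n∸n≡m; ≡ᵇ⇒≡)
open import Data.Nat.ListAction using (sum)
open import Data.Nat.Tactic.RingSolver using (solve-∀)
open import Algebra.Properties.Semiring.Sum +-*-semiring
  using (sum-syntax; sum-cong-≗; ∑-distrib-+; ∑-comm; *-distribˡ-sum; *-distribʳ-sum; sum-replicate-zero)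
  renaming (sum to ∑)
open import Data.Fin using (Fin; zero; suc)
open import Data.Fin.Properties using (_≟_; suc-injective)
open import Data.Bool using (Bool; true; false; T; _∧_; _∨_; not)
open import Data.Bool.Properties using (T-∧; T-∨; T-≡)
open import Function.Bundles using (Equivalence)
open Equivalence using (to; from)
open import Data.List using (List; []; _∷_; length; filterᵇ; allFin; map; tabulate; lookup)
open import Data.List.Membership.Propositional.Properties using (∈-lookup)
open import Data.Product using (_×_; _,_; proj₁; proj₂)
open import Data.Sum using (_⊎_; inj₁; inj₂)
open import Data.Empty using (⊥)
open import Data.Unit using (tt)
open import Function using (_∘_)
open import Relation.Nullary using (¬_; yes; no; contradiction)
open import Relation.Nullary.Decidable using (T?)
open import Relation.Binary.PropositionalEquality
  using (_≡_; _≢_; ≢-sym; refl; sym; trans; cong; cong₂; subst; module ≡-Reasoning)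

𝟙 : Bool → ℕ
𝟙 true  = 1
𝟙 false = 0

𝟙-∧ : ∀ a b → 𝟙 (a ∧ b) ≡ 𝟙 a * 𝟙 b
𝟙-∧ false b     = refl
𝟙-∧ true  false = refl
𝟙-∧ true  true  = refl

𝟙-T : ∀ {b} → T b → 𝟙 b ≡ 1
𝟙-T {true} _ = refl

𝟙-¬T : ∀ {b} → ¬ T b → 𝟙 b ≡ 0
𝟙-¬T {false} _ = refl
𝟙-¬T {true}  ¬t = contradiction tt ¬t

𝟙-*-cong : ∀ b {x y} → (T b → x ≡ y) → 𝟙 b * x ≡ 𝟙 b * y
𝟙-*-cong false _   = refl
𝟙-*-cong true  x≡y = cong (_+ 0) (x≡y tt)

𝟙-∨ : ∀ a b → (T a → T b → ⊥) → 𝟙 (a ∨ b) ≡ 𝟙 a + 𝟙 b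
𝟙-∨ false b     _ = refl
𝟙-∨ true  false _ = refl
𝟙-∨ true  true  disjoint = contradiction tt (disjoint tt)

∑-point : ∀ {n} (f : Fin n → ℕ) (a : Fin n) → (∀ i → i ≢ a → f i ≡ 0) → ∑[ i < n ] f i ≡ f a
∑-point {suc n} f zero vanish = begin
  f zero + ∑[ i < n ] f (suc i) ≡⟨ cong (f zero +_) (sum-cong-≗ (λ i → vanish (suc i) λ ())) ⟩
  f zero + ∑[ i < n ] 0         ≡⟨ cong (f zero +_) (sum-replicate-zero n) ⟩
  f zero + 0                    ≡⟨ +-comm (f zero) 0 ⟩
  f zero                        ∎
  where open ≡-Reasoning
∑-point {suc n} f (suc a) vanish = cong₂ _+_ (vanish zero λ ()) (∑-point (f ∘ suc) a (λ i i≢a → vanish (suc i) (i≢a ∘ suc-injective)))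

term-≤-∑ : ∀ {n} (f : Fin n → ℕ) i → f i ≤ ∑[ j < n ] f j
term-≤-∑ f zero    = m≤m+n (f zero) _
term-≤-∑ f (suc i) = ≤-trans (term-≤-∑ (f ∘ suc) i) (m≤n+m _ (f zero))

two-terms-≤-∑ : ∀ {n} (f : Fin n → ℕ) {i j} → i ≢ j → f i + f j ≤ ∑[ k < n ] f k
two-terms-≤-∑ f {zero}  {zero}  i≢j = contradiction refl i≢j
two-terms-≤-∑ f {zero}  {suc j} _   = +-monoʳ-≤ (f zero) (term-≤-∑ (f ∘ suc) j)
two-terms-≤-∑ f {suc i} {zero}  _   =
  ≤-trans (≤-reflexive (+-comm (f (suc i)) (f zero))) (+-monoʳ-≤ (f zero) (term-≤-∑ (f ∘ suc) i))
two-terms-≤-∑ f {suc i} {suc j} i≢j =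
  ≤-trans (two-terms-≤-∑ (f ∘ suc) (i≢j ∘ cong suc)) (m≤n+m _ (f zero))

∑-scale : ∀ {n} k (f : Fin n → ℕ) → ∑[ i < n ] (k * f i) ≡ k * ∑[ i < n ] f i
∑-scale k f = sym (*-distribˡ-sum k f)

only-2 : ∀ {d} → d ≢ 0 → d ≢ 1 → d ≤ 2 → d ≡ 2
only-2 {0}               d≢0 _   _ = contradiction refl d≢0
only-2 {1}               _   d≢1 _ = contradiction refl d≢1
only-2 {2}               _   _   _ = refl
only-2 {suc (suc (suc d))} _ _ (s≤s (s≤s ()))

count-filter : ∀ {A : Set} (p : A → Bool) (xs : List A) →
               length (filterᵇ p xs) ≡ ∑[ i < length xs ] 𝟙 (p (lookup xs i))
count-filter p []       = refl
count-filter p (x ∷ xs) with p x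
... | true  = cong suc (count-filter p xs)
... | false = count-filter p xs

count-tabulate : ∀ {A : Set} {n} (p : A → Bool) (g : Fin n → A) →
                 length (filterᵇ p (tabulate g)) ≡ ∑[ i < n ] 𝟙 (p (g i))
count-tabulate {n = zero}  p g = refl
count-tabulate {n = suc n} p g with p (g zero)
... | true  = cong suc (count-tabulate p (g ∘ suc))
... | false = count-tabulate p (g ∘ suc)

count-allFin : ∀ {n} (p : Fin n → Bool) → length (filterᵇ p (allFin n)) ≡ ∑[ i < n ] 𝟙 (p i)
count-allFin p = count-tabulate p (λ i → i)

sum-map-allFin : ∀ {n} (f : Fin n → ℕ) → sum (map f (allFin n)) ≡ ∑[ i < n ] f i
sum-map-allFin = go (λ i → i)
  where
  go : ∀ {A : Set} {n} (g : Fin n → A) (f : A → ℕ) → sum (map f (tabulate g)) ≡ ∑[ i < n ] f (g i)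
  go {n = zero}  g f = refl
  go {n = suc n} g f = cong (f (g zero) +_) (go (g ∘ suc) f)

module Digraph {m : ℕ} (E : Fin m → Fin m → Bool) where

  ∑² : (Fin m → Fin m → ℕ) → ℕ
  ∑² f = ∑[ u < m ] ∑[ v < m ] f u v

  ∑²-cong : ∀ {f g : Fin m → Fin m → ℕ} → (∀ u v → f u v ≡ g u v) → ∑² f ≡ ∑² g
  ∑²-cong f≡g = sum-cong-≗ (λ u → sum-cong-≗ (f≡g u))

  ∑²-distrib-+ : ∀ (f g : Fin m → Fin m → ℕ) → ∑² (λ u v → f u v + g u v) ≡ ∑² f + ∑² g
  ∑²-distrib-+ f g =
    trans (sum-cong-≗ (λ u → ∑-distrib-+ (f u) (g u))) (∑-distrib-+ (λ u → ∑[ v < m ] f u v) _)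

  ==-refl : ∀ u → _==_ E u u ≡ true
  ==-refl u with u ≟ u
  ... | yes _   = refl
  ... | no u≢u = contradiction refl u≢u

  ==-false : ∀ {u v} → u ≢ v → _==_ E u v ≡ false
  ==-false {u} {v} u≢v with u ≟ v
  ... | yes u≡v = contradiction u≡v u≢v
  ... | no _    = refl

  ==-sound : ∀ {u v} → T (_==_ E u v) → u ≡ v
  ==-sound {u} {v} t with u ≟ v
  ... | yes u≡v = u≡v

  ≢-of-not : ∀ {u v} → T (not (_==_ E u v)) → u ≢ v
  ≢-of-not {u} u≠u refl = subst (T ∘ not) (==-refl u) u≠u

  not-of-≢ : ∀ {u v} → u ≢ v → T (not (_==_ E u v))
  not-of-≢ u≢v = subst (T ∘ not) (sym (==-false u≢v)) tt

  ∑-select : ∀ (f : Fin m → ℕ) a → ∑[ u < m ] (𝟙 (_==_ E u a) * f u) ≡ f a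
  ∑-select f a = trans (∑-point _ a (λ u u≢a → cong (λ b → 𝟙 b * f u) (==-false u≢a)))
                       (trans (cong (λ b → 𝟙 b * f a) (==-refl a)) (+-identityʳ (f a)))

  arc : Fin m → Fin m → Fin m → Fin m → Bool
  arc a b u v = _==_ E u a ∧ _==_ E v b

  ∑²-arc : ∀ (f : Fin m → Fin m → ℕ) a b → ∑² (λ u v → 𝟙 (arc a b u v) * f u v) ≡ f a b
  ∑²-arc f a b = begin
    ∑² (λ u v → 𝟙 (arc a b u v) * f u v)
      ≡⟨ ∑²-cong (λ u v → trans (cong (_* f u v) (𝟙-∧ (_==_ E u a) (_==_ E v b)))
                                (*-assoc (𝟙 (_==_ E u a)) _ _)) ⟩
    ∑[ u < m ] ∑[ v < m ] (𝟙 (_==_ E u a) * (𝟙 (_==_ E v b) * f u v))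
      ≡⟨ sum-cong-≗ (λ u → sym (*-distribˡ-sum (𝟙 (_==_ E u a)) (λ v → 𝟙 (_==_ E v b) * f u v))) ⟩
    ∑[ u < m ] (𝟙 (_==_ E u a) * ∑[ v < m ] (𝟙 (_==_ E v b) * f u v))
      ≡⟨ ∑-select (λ u → ∑[ v < m ] (𝟙 (_==_ E v b) * f u v)) a ⟩
    ∑[ v < m ] (𝟙 (_==_ E v b) * f a v)
      ≡⟨ ∑-select (f a) b ⟩
    f a b ∎
    where open ≡-Reasoning

  arc-sound : ∀ {a b} u v → T (arc a b u v) → u ≡ a × v ≡ b
  arc-sound {a} {b} u v uv≡ab with T-∧ {_==_ E u a} {_==_ E v b} .to uv≡ab
  ... | u≡a , v≡b = ==-sound u≡a , ==-sound v≡b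

  arc-disjoint : ∀ {a b c d} u v → (a ≢ c ⊎ b ≢ d) → T (arc a b u v) → T (arc c d u v) → ⊥
  arc-disjoint u v a≢c⊎b≢d uv≡ab uv≡cd with arc-sound u v uv≡ab | arc-sound u v uv≡cd
  ... | refl , refl | refl , refl with a≢c⊎b≢d
  ...   | inj₁ a≢a = a≢a refl
  ...   | inj₂ b≢b = b≢b refl

  ∑²-∨ : ∀ (A B : Fin m → Fin m → Bool) (f : Fin m → Fin m → ℕ) →
         (∀ u v → T (A u v) → T (B u v) → ⊥) →
         ∑² (λ u v → 𝟙 (A u v ∨ B u v) * f u v)
           ≡ ∑² (λ u v → 𝟙 (A u v) * f u v) + ∑² (λ u v → 𝟙 (B u v) * f u v)
  ∑²-∨ A B f disjoint = trans
    (∑²-cong (λ u v → trans (cong (_* f u v) (𝟙-∨ (A u v) (B u v) (disjoint u v)))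
                            (*-distribʳ-+ (f u v) (𝟙 (A u v)) (𝟙 (B u v)))))
    (∑²-distrib-+ (λ u v → 𝟙 (A u v) * f u v) (λ u v → 𝟙 (B u v) * f u v))

  indeg-∑ : ∀ v → indeg E v ≡ ∑[ u < m ] 𝟙 (E u v)
  indeg-∑ v = count-allFin (λ u → E u v)

  outdeg-∑ : ∀ u → outdeg E u ≡ ∑[ v < m ] 𝟙 (E u v)
  outdeg-∑ u = count-allFin (E u)

  outdeg-when : ∀ b u → ∑[ v < m ] 𝟙 (b ∧ E u v) ≡ 𝟙 b * outdeg E u
  outdeg-when b u = begin
    ∑[ v < m ] 𝟙 (b ∧ E u v)        ≡⟨ sum-cong-≗ (λ v → 𝟙-∧ b (E u v)) ⟩
    ∑[ v < m ] (𝟙 b * 𝟙 (E u v))    ≡⟨ *-distribˡ-sum (𝟙 b) (λ v → 𝟙 (E u v)) ⟨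
    𝟙 b * ∑[ v < m ] 𝟙 (E u v)      ≡⟨ cong (𝟙 b *_) (outdeg-∑ u) ⟨
    𝟙 b * outdeg E u                ∎
    where open ≡-Reasoning

  indeg-when : ∀ b v → length (filterᵇ (λ u → E u v ∧ b) (allFin m)) ≡ indeg E v * 𝟙 b
  indeg-when b v = begin
    length (filterᵇ (λ u → E u v ∧ b) (allFin m)) ≡⟨ count-allFin (λ u → E u v ∧ b) ⟩
    ∑[ u < m ] 𝟙 (E u v ∧ b)                      ≡⟨ sum-cong-≗ (λ u → 𝟙-∧ (E u v) b) ⟩
    ∑[ u < m ] (𝟙 (E u v) * 𝟙 b)                  ≡⟨ *-distribʳ-sum (𝟙 b) (λ u → 𝟙 (E u v)) ⟨
    ∑[ u < m ] 𝟙 (E u v) * 𝟙 b                    ≡⟨ cong (_* 𝟙 b) (indeg-∑ v) ⟨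
    indeg E v * 𝟙 b                               ∎
    where open ≡-Reasoning

  handshake : ∑[ v < m ] indeg E v ≡ ∑[ u < m ] outdeg E u
  handshake = begin
    ∑[ v < m ] indeg E v               ≡⟨ sum-cong-≗ indeg-∑ ⟩
    ∑[ v < m ] ∑[ u < m ] 𝟙 (E u v)    ≡⟨ ∑-comm (λ v u → 𝟙 (E u v)) ⟩
    ∑[ u < m ] ∑[ v < m ] 𝟙 (E u v)    ≡⟨ sum-cong-≗ outdeg-∑ ⟨
    ∑[ u < m ] outdeg E u              ∎
    where open ≡-Reasoning

  two-children : ∀ {u x y} → T (E u x) → T (E u y) → x ≢ y → 2 ≤ outdeg E u
  two-children {u} {x} {y} ux uy x≢y = begin
    2                            ≡⟨ cong₂ _+_ (𝟙-T ux) (𝟙-T uy) ⟨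
    𝟙 (E u x) + 𝟙 (E u y)        ≤⟨ two-terms-≤-∑ (λ v → 𝟙 (E u v)) x≢y ⟩
    ∑[ v < m ] 𝟙 (E u v)         ≡⟨ outdeg-∑ u ⟨
    outdeg E u                   ∎
    where open ≤-Reasoning

module Network {m : ℕ} {E : Fin m → Fin m → Bool} (N : IsNetwork m E) where
  open IsNetwork N
  open Digraph E

  isLeaf-by-degrees : ∀ {v i o} → indeg E v ≡ i → outdeg E v ≡ o →
                      isLeafᵇ E v ≡ (i ≡ᵇ 1) ∧ (o ≡ᵇ 0)
  isLeaf-by-degrees refl refl = refl

  ret-parts : ∀ {v} → T (isRetᵇ N v) → v ≢ root × ¬ T (isLeafᵇ E v) × outdeg E v ≡ 1
  ret-parts {v} ret with T-∧ {not (_==_ E v root)} .to ret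
  ... | not-root , rest with T-∧ {not (isLeafᵇ E v)} .to rest
  ...   | not-leaf , out≡1 =
    ≢-of-not not-root ,
    (λ leaf → subst (T ∘ not) (T-≡ .to leaf) not-leaf) ,
    ≡ᵇ⇒≡ (outdeg E v) 1 out≡1

  branching-not-root : ∀ {u} → 2 ≤ outdeg E u → u ≢ root
  branching-not-root 2≤out refl with subst (2 ≤_) root-out 2≤out
  ... | s≤s ()

  branching-not-ret : ∀ {u} → 2 ≤ outdeg E u → ¬ T (isRetᵇ N u)
  branching-not-ret 2≤out ret with ret-parts ret
  ... | _ , _ , out≡1 with subst (2 ≤_) out≡1 2≤out
  ...   | s≤s ()

  -- The edges not leaving the root (exactly the edges a cherry decomposition
  -- must cover), and the edges leaving a reticulation.
  nonRootEdge retEdge : Fin m → Fin m → Bool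
  nonRootEdge u v = not (_==_ E u root) ∧ E u v
  retEdge     u v = isRetᵇ N u ∧ E u v

  nonRootEdge-sound : ∀ u v → T (nonRootEdge u v) → T (E u v) × u ≢ root
  nonRootEdge-sound u v uv with T-∧ {not (_==_ E u root)} .to uv
  ... | u≢root , e = e , ≢-of-not u≢root

  retEdge-sound : ∀ u v → T (retEdge u v) → T (E u v) × u ≢ root
  retEdge-sound u v uv with T-∧ {isRetᵇ N u} .to uv
  ... | ret , e = e , proj₁ (ret-parts ret)

  outdeg-split : ∀ u → 𝟙 (_==_ E u root) + ∑[ v < m ] 𝟙 (nonRootEdge u v) ≡ outdeg E u
  outdeg-split u with u ≟ root
  ... | yes refl = trans (cong (1 +_) (outdeg-when false root)) (sym root-out)
  ... | no _     = trans (outdeg-when true u) (+-identityʳ (outdeg E u))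

  retEdges-at : ∀ u → ∑[ v < m ] 𝟙 (retEdge u v) ≡ 𝟙 (isRetᵇ N u)
  retEdges-at u = begin
    ∑[ v < m ] 𝟙 (retEdge u v)       ≡⟨ outdeg-when (isRetᵇ N u) u ⟩
    𝟙 (isRetᵇ N u) * outdeg E u      ≡⟨ 𝟙-*-cong (isRetᵇ N u) (proj₂ ∘ proj₂ ∘ ret-parts) ⟩
    𝟙 (isRetᵇ N u) * 1               ≡⟨ *-identityʳ (𝟙 (isRetᵇ N u)) ⟩
    𝟙 (isRetᵇ N u)                   ∎
    where open ≡-Reasoning

  leafCount retCount edgeCount : ℕ
  leafCount = ∑[ v < m ] 𝟙 (isLeafᵇ E v)
  retCount  = ∑[ v < m ] 𝟙 (isRetᵇ N v)
  edgeCount = ∑[ u < m ] outdeg E u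

  root-count : ∑[ v < m ] 𝟙 (_==_ E v root) ≡ 1
  root-count = trans (∑-point _ root (λ v v≢root → cong 𝟙 (==-false v≢root))) (cong 𝟙 (==-refl root))

  edgeCount-split : edgeCount ≡ 1 + ∑² (λ u v → 𝟙 (nonRootEdge u v))
  edgeCount-split = begin
    ∑[ u < m ] outdeg E u
      ≡⟨ sum-cong-≗ outdeg-split ⟨
    ∑[ u < m ] (𝟙 (_==_ E u root) + ∑[ v < m ] 𝟙 (nonRootEdge u v))
      ≡⟨ ∑-distrib-+ (λ u → 𝟙 (_==_ E u root)) _ ⟩
    ∑[ u < m ] 𝟙 (_==_ E u root) + ∑² (λ u v → 𝟙 (nonRootEdge u v))
      ≡⟨ cong (_+ ∑² (λ u v → 𝟙 (nonRootEdge u v))) root-count ⟩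
    1 + ∑² (λ u v → 𝟙 (nonRootEdge u v)) ∎
    where open ≡-Reasoning

  retEdges-total : ∑² (λ u v → 𝟙 (retEdge u v)) ≡ retCount
  retEdges-total = sum-cong-≗ retEdges-at

  leaf-degrees : ∀ {v} → T (isLeafᵇ E v) → indeg E v ≡ 1 × outdeg E v ≡ 0
  leaf-degrees {v} leaf with T-∧ {indeg E v ≡ᵇ 1} .to leaf
  ... | in≡1 , out≡0 = ≡ᵇ⇒≡ (indeg E v) 1 in≡1 , ≡ᵇ⇒≡ (outdeg E v) 0 out≡0

  -- The local degree identity 2·indeg + [root] = outdeg + 2·[leaf] + 3·[reticulation],
  -- which only depends on the degrees of v and on whether v is the root.
  Balanced : Fin m → Set
  Balanced v = 2 * indeg E v + 𝟙 (_==_ E v root) ≡ outdeg E v + 2 * 𝟙 (isLeafᵇ E v) + 3 * 𝟙 (isRetᵇ N v)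

  balanced-by-degrees : ∀ {v i o b} → indeg E v ≡ i → outdeg E v ≡ o → _==_ E v root ≡ b →
    let leaf = (i ≡ᵇ 1) ∧ (o ≡ᵇ 0) in
    2 * i + 𝟙 b ≡ o + 2 * 𝟙 leaf + 3 * 𝟙 (not b ∧ not leaf ∧ (o ≡ᵇ 1)) → Balanced v
  balanced-by-degrees refl refl refl balanced = balanced

  module Binary (binary : IsBinary E) where

    data Kind (v : Fin m) : Set where
      root-kind : v ≡ root → Kind v
      leaf-kind : v ≢ root → indeg E v ≡ 1 → outdeg E v ≡ 0 → Kind v
      tree-kind : v ≢ root → indeg E v ≡ 1 → outdeg E v ≡ 2 → Kind v
      ret-kind  : v ≢ root → indeg E v ≡ 2 → outdeg E v ≡ 1 → Kind v

    kind : ∀ v → Kind v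
    kind v with v ≟ root
    ... | yes v≡root = root-kind v≡root
    ... | no v≢root with T? (isLeafᵇ E v)
    ...   | yes leaf = leaf-kind v≢root (proj₁ (leaf-degrees leaf)) (proj₂ (leaf-degrees leaf))
    ...   | no ¬leaf with other v v≢root ¬leaf
    ...     | inj₁ (in≡1 , out≢1) = tree-kind v≢root in≡1 (only-2 out≢0 out≢1 out≤2)
      where
      out≢0 : outdeg E v ≢ 0
      out≢0 out≡0 = ¬leaf (subst T (sym (isLeaf-by-degrees in≡1 out≡0)) tt)
      out≤2 : outdeg E v ≤ 2
      out≤2 = s≤s⁻¹ (subst (λ i → i + outdeg E v ≤ 3) in≡1 (binary v))
    ...     | inj₂ (out≡1 , in≢1) = ret-kind v≢root (only-2 in≢0 in≢1 in≤2) out≡1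
      where
      in≢0 : indeg E v ≢ 0
      in≢0 in≡0 = v≢root (root-unique v in≡0)
      in≤2 : indeg E v ≤ 2
      in≤2 = s≤s⁻¹ (subst (_≤ 3) (trans (cong (indeg E v +_) out≡1) (+-comm (indeg E v) 1)) (binary v))

    balanced : ∀ v → Balanced v
    balanced v with kind v
    ... | root-kind refl          = balanced-by-degrees root-in root-out (==-refl root) refl
    ... | leaf-kind v≢root in≡ out≡ = balanced-by-degrees in≡ out≡ (==-false v≢root) refl
    ... | tree-kind v≢root in≡ out≡ = balanced-by-degrees in≡ out≡ (==-false v≢root) refl
    ... | ret-kind  v≢root in≡ out≡ = balanced-by-degrees in≡ out≡ (==-false v≢root) refl

    ret-indeg : ∀ {v} → T (isRetᵇ N v) → indeg E v ≡ 2
    ret-indeg {v} ret with kind v | ret-parts ret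
    ... | root-kind v≡root    | v≢root , _ , _     = contradiction v≡root v≢root
    ... | leaf-kind _ _ out≡0 | _ , _ , out≡1     = contradiction (trans (sym out≡1) out≡0) λ ()
    ... | tree-kind _ _ out≡2 | _ , _ , out≡1     = contradiction (trans (sym out≡1) out≡2) λ ()
    ... | ret-kind _ in≡2 _   | _                 = in≡2

    retEdges-into : ∀ v → length (filterᵇ (λ u → E u v ∧ isRetᵇ N v) (allFin m)) ≡ 2 * 𝟙 (isRetᵇ N v)
    retEdges-into v = begin
      length (filterᵇ (λ u → E u v ∧ isRetᵇ N v) (allFin m)) ≡⟨ indeg-when (isRetᵇ N v) v ⟩
      indeg E v * 𝟙 (isRetᵇ N v)                            ≡⟨ *-comm (indeg E v) (𝟙 (isRetᵇ N v)) ⟩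
      𝟙 (isRetᵇ N v) * indeg E v                            ≡⟨ 𝟙-*-cong (isRetᵇ N v) ret-indeg ⟩
      𝟙 (isRetᵇ N v) * 2                                    ≡⟨ *-comm (𝟙 (isRetᵇ N v)) 2 ⟩
      2 * 𝟙 (isRetᵇ N v)                                    ∎
      where open ≡-Reasoning

    degree-sum : 2 * edgeCount + 1 ≡ edgeCount + 2 * leafCount + 3 * retCount
    degree-sum = begin
      2 * edgeCount + 1
        ≡⟨ cong₂ (λ d r → 2 * d + r) handshake root-count ⟨
      2 * ∑[ v < m ] indeg E v + ∑[ v < m ] 𝟙 (_==_ E v root)
        ≡⟨ cong (_+ ∑[ v < m ] 𝟙 (_==_ E v root)) (∑-scale 2 (indeg E)) ⟨
      ∑[ v < m ] (2 * indeg E v) + ∑[ v < m ] 𝟙 (_==_ E v root)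
        ≡⟨ ∑-distrib-+ (λ v → 2 * indeg E v) (λ v → 𝟙 (_==_ E v root)) ⟨
      ∑[ v < m ] (2 * indeg E v + 𝟙 (_==_ E v root))
        ≡⟨ sum-cong-≗ balanced ⟩
      ∑[ v < m ] (outdeg E v + 2 * 𝟙 (isLeafᵇ E v) + 3 * 𝟙 (isRetᵇ N v))
        ≡⟨ ∑-distrib-+ (λ v → outdeg E v + 2 * 𝟙 (isLeafᵇ E v)) (λ v → 3 * 𝟙 (isRetᵇ N v)) ⟩
      ∑[ v < m ] (outdeg E v + 2 * 𝟙 (isLeafᵇ E v)) + ∑[ v < m ] (3 * 𝟙 (isRetᵇ N v))
        ≡⟨ cong₂ _+_ (∑-distrib-+ (outdeg E) (λ v → 2 * 𝟙 (isLeafᵇ E v)))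
                     (∑-scale 3 (λ v → 𝟙 (isRetᵇ N v))) ⟩
      edgeCount + ∑[ v < m ] (2 * 𝟙 (isLeafᵇ E v)) + 3 * retCount
        ≡⟨ cong (λ l → edgeCount + l + 3 * retCount) (∑-scale 2 (λ v → 𝟙 (isLeafᵇ E v))) ⟩
      edgeCount + 2 * leafCount + 3 * retCount ∎
      where open ≡-Reasoning

    -- A reticulation has two incoming edges, so the reticulation number is
    -- 2·(#reticulations) − #reticulations.
    reticulationNumber≡retCount : reticulationNumber N ≡ retCount
    reticulationNumber≡retCount = begin
      numReticulationEdges N ∸ numReticulations N
        ≡⟨ cong₂ _∸_ (trans (sum-map-allFin (λ v → length (filterᵇ (λ u → E u v ∧ isRetᵇ N v) (allFin m)))) (sum-cong-≗ retEdges-into)) (count-allFin (isRetᵇ N)) ⟩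
      ∑[ v < m ] (2 * 𝟙 (isRetᵇ N v)) ∸ retCount
        ≡⟨ cong (_∸ retCount) (∑-scale 2 (λ v → 𝟙 (isRetᵇ N v))) ⟩
      2 * retCount ∸ retCount
        ≡⟨ cong (_∸ retCount) (cong (retCount +_) (+-identityʳ retCount)) ⟩
      retCount + retCount ∸ retCount
        ≡⟨ m+n∸n≡m retCount retCount ⟩
      retCount ∎
      where open ≡-Reasoning

module ShapeEdges {m : ℕ} {E : Fin m → Fin m → Bool} (N : IsNetwork m E) where
  open IsNetwork N
  open Digraph E
  open Network N

  edgesIn : (Fin m → Fin m → Bool) → Shape m → ℕ
  edgesIn w s = ∑² (λ u v → 𝟙 (edgeInᵇ N u v s) * 𝟙 (w u v))

  -- The edges of a shape are pairwise distinct, so each is counted once.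
  edgesIn-cherry : ∀ w p x y → x ≢ y → edgesIn w (cherry p x y) ≡ 𝟙 (w p x) + 𝟙 (w p y)
  edgesIn-cherry w p x y x≢y = begin
    edgesIn w (cherry p x y)
      ≡⟨ ∑²-∨ (arc p x) (arc p y) W (λ u v → arc-disjoint u v (inj₂ x≢y)) ⟩
    ∑² (λ u v → 𝟙 (arc p x u v) * W u v) + ∑² (λ u v → 𝟙 (arc p y u v) * W u v)
      ≡⟨ cong₂ _+_ (∑²-arc W p x) (∑²-arc W p y) ⟩
    W p x + W p y ∎
    where
    open ≡-Reasoning
    W : Fin m → Fin m → ℕ
    W u v = 𝟙 (w u v)

  edgesIn-retCherry : ∀ w x y px py → px ≢ py → px ≢ y →
    edgesIn w (retCherry x y px py) ≡ 𝟙 (w px x) + (𝟙 (w py px) + 𝟙 (w py y))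
  edgesIn-retCherry w x y px py px≢py px≢y = begin
    edgesIn w (retCherry x y px py)
      ≡⟨ ∑²-∨ (arc px x) (λ u v → arc py px u v ∨ arc py y u v) W first-disjoint ⟩
    ∑² (λ u v → 𝟙 (arc px x u v) * W u v) + ∑² (λ u v → 𝟙 (arc py px u v ∨ arc py y u v) * W u v)
      ≡⟨ cong (∑² (λ u v → 𝟙 (arc px x u v) * W u v) +_) (∑²-∨ (arc py px) (arc py y) W (λ u v → arc-disjoint u v (inj₂ px≢y))) ⟩
    ∑² (λ u v → 𝟙 (arc px x u v) * W u v)
      + (∑² (λ u v → 𝟙 (arc py px u v) * W u v) + ∑² (λ u v → 𝟙 (arc py y u v) * W u v))
      ≡⟨ cong₂ _+_ (∑²-arc W px x) (cong₂ _+_ (∑²-arc W py px) (∑²-arc W py y)) ⟩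
    W px x + (W py px + W py y) ∎
    where
    open ≡-Reasoning
    W : Fin m → Fin m → ℕ
    W u v = 𝟙 (w u v)
    first-disjoint : ∀ u v → T (arc px x u v) → T (arc py px u v ∨ arc py y u v) → ⊥
    first-disjoint u v first rest with T-∨ {arc py px u v} .to rest
    ... | inj₁ second = arc-disjoint u v (inj₁ px≢py) first second
    ... | inj₂ third  = arc-disjoint u v (inj₁ px≢py) first third

  nonRootEdge-𝟙 : ∀ {u v} → u ≢ root → T (E u v) → 𝟙 (nonRootEdge u v) ≡ 1
  nonRootEdge-𝟙 {u} {v} u≢root e = 𝟙-T (T-∧ {not (_==_ E u root)} {E u v} .from (not-of-≢ u≢root , e))

  retEdge-𝟙 : ∀ {u v} → T (isRetᵇ N u) → T (E u v) → 𝟙 (retEdge u v) ≡ 1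
  retEdge-𝟙 {u} {v} ret e = 𝟙-T (T-∧ {isRetᵇ N u} {E u v} .from (ret , e))

  nonRetEdge-𝟙 : ∀ u v → ¬ T (isRetᵇ N u) → 𝟙 (retEdge u v) ≡ 0
  nonRetEdge-𝟙 u v ¬ret = trans (𝟙-∧ (isRetᵇ N u) (E u v)) (cong (_* 𝟙 (E u v)) (𝟙-¬T ¬ret))

  -- All edges of a shape avoid the root edge: the parent in a cherry and the
  -- parent p_y in a reticulated cherry have two children, p_x is a reticulation.
  nonRootEdges-in : ∀ s → ValidShape N s →
                    edgesIn nonRootEdge s ≡ 2 * 𝟙 (isCherryᵇ s) + 3 * 𝟙 (isRetCherryᵇ s)
  nonRootEdges-in (cherry p x y) ((_ , _ , x≢y) , p→x , p→y) =
    trans (edgesIn-cherry nonRootEdge p x y x≢y)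
          (cong₂ _+_ (nonRootEdge-𝟙 p≢root p→x) (nonRootEdge-𝟙 p≢root p→y))
    where
    p≢root : p ≢ root
    p≢root = branching-not-root (two-children p→x p→y x≢y)
  nonRootEdges-in (retCherry x y px py) ((_ , _ , _ , y≢px , _ , px≢py) , px→x , py→px , py→y , ret) =
    trans (edgesIn-retCherry nonRootEdge x y px py px≢py (≢-sym y≢px))
          (cong₂ _+_ (nonRootEdge-𝟙 (proj₁ (ret-parts ret)) px→x)
                     (cong₂ _+_ (nonRootEdge-𝟙 py≢root py→px) (nonRootEdge-𝟙 py≢root py→y)))
    where
    py≢root : py ≢ root
    py≢root = branching-not-root (two-children py→px py→y (≢-sym y≢px))

  retEdges-in : ∀ s → ValidShape N s → edgesIn retEdge s ≡ 𝟙 (isRetCherryᵇ s)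
  retEdges-in (cherry p x y) ((_ , _ , x≢y) , p→x , p→y) =
    trans (edgesIn-cherry retEdge p x y x≢y) (cong₂ _+_ (nonRetEdge-𝟙 p x p-not-ret) (nonRetEdge-𝟙 p y p-not-ret))
    where
    p-not-ret : ¬ T (isRetᵇ N p)
    p-not-ret = branching-not-ret (two-children p→x p→y x≢y)
  retEdges-in (retCherry x y px py) ((_ , _ , _ , y≢px , _ , px≢py) , px→x , py→px , py→y , ret) =
    trans (edgesIn-retCherry retEdge x y px py px≢py (≢-sym y≢px))
          (cong₂ _+_ (retEdge-𝟙 ret px→x)
                     (cong₂ _+_ (nonRetEdge-𝟙 py px py-not-ret) (nonRetEdge-𝟙 py y py-not-ret)))
    where
    py-not-ret : ¬ T (isRetᵇ N py)
    py-not-ret = branching-not-ret (two-children py→px py→y (≢-sym y≢px))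

module Decomposition {m : ℕ} {E : Fin m → Fin m → Bool} (N : IsNetwork m E)
                     (P : List (Shape m)) (cd : IsCherryDecomposition N P) where
  open IsNetwork N
  open IsCherryDecomposition cd
  open Digraph E
  open Network N
  open ShapeEdges N

  ∑ₚ : (Shape m → ℕ) → ℕ
  ∑ₚ f = ∑[ i < length P ] f (lookup P i)

  double-count : ∀ w → (∀ u v → T (w u v) → T (E u v) × u ≢ root) →
                 ∑² (λ u v → 𝟙 (w u v)) ≡ ∑ₚ (edgesIn w)
  double-count w w-sound = begin
    ∑² (λ u v → 𝟙 (w u v))
      ≡⟨ ∑²-cong counted-once ⟩
    ∑[ u < m ] ∑[ v < m ] ∑ₚ (λ s → 𝟙 (edgeInᵇ N u v s) * 𝟙 (w u v))
      ≡⟨ sum-cong-≗ (λ u → ∑-comm (λ v i → 𝟙 (edgeInᵇ N u v (lookup P i)) * 𝟙 (w u v))) ⟩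
    ∑[ u < m ] ∑ₚ (λ s → ∑[ v < m ] (𝟙 (edgeInᵇ N u v s) * 𝟙 (w u v)))
      ≡⟨ ∑-comm (λ u i → ∑[ v < m ] (𝟙 (edgeInᵇ N u v (lookup P i)) * 𝟙 (w u v))) ⟩
    ∑ₚ (edgesIn w) ∎
    where
    open ≡-Reasoning
    counted-once : ∀ u v → 𝟙 (w u v) ≡ ∑ₚ (λ s → 𝟙 (edgeInᵇ N u v s) * 𝟙 (w u v))
    counted-once u v = begin
      𝟙 (w u v)                                        ≡⟨ *-identityʳ (𝟙 (w u v)) ⟨
      𝟙 (w u v) * 1                                    ≡⟨ 𝟙-*-cong (w u v) cover-once ⟨
      𝟙 (w u v) * ∑ₚ (λ s → 𝟙 (edgeInᵇ N u v s))       ≡⟨ *-comm (𝟙 (w u v)) _ ⟩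
      ∑ₚ (λ s → 𝟙 (edgeInᵇ N u v s)) * 𝟙 (w u v)       ≡⟨ *-distribʳ-sum (𝟙 (w u v)) (λ i → 𝟙 (edgeInᵇ N u v (lookup P i))) ⟩
      ∑ₚ (λ s → 𝟙 (edgeInᵇ N u v s) * 𝟙 (w u v))       ∎
      where
      cover-once : T (w u v) → ∑ₚ (λ s → 𝟙 (edgeInᵇ N u v s)) ≡ 1
      cover-once wuv with w-sound u v wuv
      ... | e , u≢root = trans (sym (count-filter (edgeInᵇ N u v) P)) (cover u v e u≢root)

  cherries retCherries : ℕ
  cherries    = ∑ₚ (𝟙 ∘ isCherryᵇ)
  retCherries = ∑ₚ (𝟙 ∘ isRetCherryᵇ)

  nonRootEdges-by-shapes : ∑² (λ u v → 𝟙 (nonRootEdge u v)) ≡ 2 * cherries + 3 * retCherries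
  nonRootEdges-by-shapes = begin
    ∑² (λ u v → 𝟙 (nonRootEdge u v))
      ≡⟨ double-count nonRootEdge nonRootEdge-sound ⟩
    ∑ₚ (edgesIn nonRootEdge)
      ≡⟨ sum-cong-≗ (λ i → nonRootEdges-in (lookup P i) (valid _ (∈-lookup i))) ⟩
    ∑ₚ (λ s → 2 * 𝟙 (isCherryᵇ s) + 3 * 𝟙 (isRetCherryᵇ s))
      ≡⟨ ∑-distrib-+ (λ i → 2 * 𝟙 (isCherryᵇ (lookup P i))) _ ⟩
    ∑ₚ (λ s → 2 * 𝟙 (isCherryᵇ s)) + ∑ₚ (λ s → 3 * 𝟙 (isRetCherryᵇ s))
      ≡⟨ cong₂ _+_ (∑-scale 2 (𝟙 ∘ isCherryᵇ ∘ lookup P))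
                   (∑-scale 3 (𝟙 ∘ isRetCherryᵇ ∘ lookup P)) ⟩
    2 * cherries + 3 * retCherries ∎
    where open ≡-Reasoning

  retEdges-by-shapes : ∑² (λ u v → 𝟙 (retEdge u v)) ≡ retCherries
  retEdges-by-shapes =
    trans (double-count retEdge retEdge-sound)
          (sum-cong-≗ (λ i → retEdges-in (lookup P i) (valid _ (∈-lookup i))))

leaves-from-counts : ∀ D n c ρ → 2 * D + 1 ≡ D + 2 * n + 3 * ρ → D ≡ 1 + (2 * c + 3 * ρ) → n ≡ 1 + c
leaves-from-counts D n c ρ degrees edges =
  sym (*-cancelˡ-≡ (1 + c) n 2 (+-cancelʳ-≡ (3 * ρ) _ _ (+-cancelˡ-≡ D _ _ (begin
    D + (2 * (1 + c) + 3 * ρ)   ≡⟨ cong (D +_) (trans (regroup c ρ) (cong (_+ 1) (sym edges))) ⟩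
    D + (D + 1)                 ≡⟨ double D ⟩
    2 * D + 1                   ≡⟨ degrees ⟩
    D + 2 * n + 3 * ρ           ≡⟨ +-assoc D (2 * n) (3 * ρ) ⟩
    D + (2 * n + 3 * ρ)         ∎))))
  where
  open ≡-Reasoning
  regroup : ∀ c ρ → 2 * (1 + c) + 3 * ρ ≡ 1 + (2 * c + 3 * ρ) + 1
  regroup = solve-∀
  double : ∀ D → D + (D + 1) ≡ 2 * D + 1
  double = solve-∀

mainTheorem3 : (m : ℕ) (E : Fin m → Fin m → Bool) (N : IsNetwork m E) →
    IsBinary E → (P : List (Shape m)) → IsCherryDecomposition N P →
    (numCherries P ≡ nLeaves E ∸ 1) × (numRetCherries P ≡ reticulationNumber N)
mainTheorem3 m E N binary P cd = cherries≡ , retCherries≡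
  where
  open Network N
  open Network.Binary N binary
  open Digraph E using (∑²)
  open Decomposition N P cd

  retCherries≡retCount : retCherries ≡ retCount
  retCherries≡retCount = trans (sym retEdges-by-shapes) retEdges-total

  leaves≡ : leafCount ≡ 1 + cherries
  leaves≡ = leaves-from-counts edgeCount leafCount cherries retCount degree-sum
    (begin
      edgeCount                                          ≡⟨ edgeCount-split ⟩
      1 + ∑² (λ u v → 𝟙 (nonRootEdge u v))               ≡⟨ cong (1 +_) nonRootEdges-by-shapes ⟩
      1 + (2 * cherries + 3 * retCherries)               ≡⟨ cong (λ k → 1 + (2 * cherries + 3 * k)) retCherries≡retCount ⟩
      1 + (2 * cherries + 3 * retCount)                  ∎)
    where open ≡-Reasoning

  cherries≡ : numCherries P ≡ nLeaves E ∸ 1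
  cherries≡ = trans (count-filter isCherryᵇ P) (sym (cong (_∸ 1) (trans (count-allFin (isLeafᵇ E)) leaves≡)))

  retCherries≡ : numRetCherries P ≡ reticulationNumber N
  retCherries≡ = trans (count-filter isRetCherryᵇ P) (trans retCherries≡retCount (sym reticulationNumber≡retCount))
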